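{- For every countable ordinal $\alpha$ with $0<\alpha<\omega_1$: (1) the $\pmb\Sigma^0_\alpha$ subsets of $2^\omega$ (Scott topology) are exactly the sets $\{X\in 2^\omega:(\mathbb N,X)\models\phi\}$ for $\phi$ an $\mathbb{N}$-$\Sigma^p_\alpha$ formula; (2) the $\pmb\Pi^0_\alpha$ subsets of $2^\omega$ are exactly the sets $\{X\in 2^\omega:(\mathbb N,X)\models\phi\}$ for $\phi$ an $\mathbb{N}$-$\Pi^p_\alpha$ formula.
   Context: The Scott topology on $2^\omega$ (ordered by $f\subseteq g$ iff $f(i)=1\Rightarrow g(i)=1$) has as basis $2^\omega$, $\emptyset$ and finite intersections of the sets $O_n=\{f:f(n)=1\}$. Borel hierarchy (Selivanov): $\pmb\Sigma^0_1$ = open sets; for $\alpha>1$, $\pmb\Sigma^0_\alpha$ = sets $\bigcup_{i\in\omega}(B_i\setminus B_i')$ with $B_i,B_i'\in\pmb\Sigma^0_{\beta_i}$, $\beta_i<\alpha$; $\pmb\Pi^0_\alpha$ = complements of $\pmb\Sigma^0_\alpha$ sets. $\mathbb{N}$-formulas are quantifier-free infinitary formulas built from atoms $\top,\bot,D(\mathbf n)$ ($D$ a unary predicate, $n\in\omega$), with $(\mathbb N,X)\models D(\mathbf n)$ iff $X(n)=1$: $\mathbb{N}$-$\Sigma^p_0$ = finite conjunctions of atoms; $\mathbb{N}$-$\Pi^p_0$ = finite disjunctions of negated atoms; $\mathbb{N}$-$\Sigma^p_1$ = countable disjunctions of $\mathbb{N}$-$\Sigma^p_0$ formulas; $\mathbb{N}$-$\Pi^p_1$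 = countable conjunctions of $\mathbb{N}$-$\Pi^p_0$ formulas; for $\alpha\ge2$, $\mathbb{N}$-$\Sigma^p_\alpha$ = countable disjunctions $\bigvee_i(\phi_i\wedge\psi_i)$ and $\mathbb{N}$-$\Pi^p_\alpha$ = countable conjunctions $\bigwedge_i(\phi_i\vee\psi_i)$ with $\phi_i\in\mathbb{N}$-$\Sigma^p_{\beta_i}$, $\psi_i\in\mathbb{N}$-$\Pi^p_{\beta_i}$, $\beta_i<\alpha$. -}

module Defs where

open import Level using (Level; 0ℓ) renaming (suc to lsuc)
open import Data.Nat using (ℕ)
open import Data.Bool using (Bool; true)
open import Data.List using (List)
open import Data.List.Relation.Unary.All using (All)
open import Data.Product using (Σ; _×_; ∃)
open import Data.Sum using (_⊎_)
open import Data.Empty using (⊥)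
open import Data.Unit using (⊤)
open import Relation.Nullary using (¬_)
open import Relation.Binary.PropositionalEquality using (_≡_)

-- Countable ordinals as Brouwer trees (every countable ordinal is the
-- value of some tree; the order is the standard one on Brouwer trees,
-- Kraus–Nordvall Forsberg–Xu).

data Ord : Set where
  ozero : Ord
  osuc  : Ord → Ord
  olim  : (ℕ → Ord) → Ord

infix 4 _≤ₒ_ _<ₒ_ _≈ₒ_

data _≤ₒ_ : Ord → Ord → Set where
  ≤-zero     : ∀ {x} → ozero ≤ₒ x
  ≤-trans    : ∀ {x y z} → x ≤ₒ y → y ≤ₒ z → x ≤ₒ z
  ≤-succ     : ∀ {x y} → x ≤ₒ y → osuc x ≤ₒ osuc y
  ≤-cocone   : ∀ {x f} (k : ℕ) → x ≤ₒ f k → x ≤ₒ olim f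
  ≤-limiting : ∀ {f x} → (∀ k → f k ≤ₒ x) → olim f ≤ₒ x

_<ₒ_ : Ord → Ord → Set
x <ₒ y = osuc x ≤ₒ y

_≈ₒ_ : Ord → Ord → Set
x ≈ₒ y = (x ≤ₒ y) × (y ≤ₒ x)

one two : Ord
one = osuc ozero
two = osuc one

Cantor : Set
Cantor = ℕ → Bool

Subset : Set₁
Subset = Cantor → Set

_⊆_ : Subset → Subset → Set
A ⊆ B = ∀ X → A X → B X

_≐_ : Subset → Subset → Set
A ≐ B = (A ⊆ B) × (B ⊆ A)

∁ : Subset → Subset
∁ A X = ¬ A X

data BasicCode : Set where
  whole : BasicCode
  empty : BasicCode
  inter : List ℕ → BasicCode

O : ℕ → Subset
O n f = f n ≡ true

Basic : BasicCode → Subset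
Basic whole X     = ⊤
Basic empty X     = ⊥
Basic (inter l) X = All (λ n → O n X) l

IsOpen : Subset → Set₁
IsOpen A = Σ Set λ I → Σ (I → BasicCode) λ b →
           A ≐ (λ X → Σ I λ i → Basic (b i) X)

-- Borel hierarchy (Selivanov), levels 1 ≤ α < ω₁.

mutual
  data BorelΣ : Ord → Subset → Set₁ where
    open₁ : ∀ {α A} → α ≈ₒ one → IsOpen A → BorelΣ α A
    union : ∀ {α A} → two ≤ₒ α →
            (β : ℕ → Ord) → (∀ i → one ≤ₒ β i) → (∀ i → β i <ₒ α) →
            (B B' : ℕ → Subset) →
            (∀ i → BorelΣ (β i) (B i)) → (∀ i → BorelΣ (β i) (B' i)) →
            A ≐ (λ X → Σ ℕ λ i → B i X × ¬ B' i X) →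
            BorelΣ α A

BorelΠ : Ord → Subset → Set₁
BorelΠ α A = BorelΣ α (∁ A)

-- ℕ-formulas (quantifier-free infinitary, countable = ℕ-indexed).

data Formula : Set where
  ⊤ᶠ ⊥ᶠ : Formula
  D     : ℕ → Formula
  ¬ᶠ_   : Formula → Formula
  _∧ᶠ_ _∨ᶠ_ : Formula → Formula → Formula
  ⋁ ⋀   : (ℕ → Formula) → Formula

_⊨_ : Cantor → Formula → Set
X ⊨ ⊤ᶠ = ⊤
X ⊨ ⊥ᶠ = ⊥
X ⊨ D n = X n ≡ true
X ⊨ (¬ᶠ φ) = ¬ (X ⊨ φ)
X ⊨ (φ ∧ᶠ ψ) = (X ⊨ φ) × (X ⊨ ψ)
X ⊨ (φ ∨ᶠ ψ) = (X ⊨ φ) ⊎ (X ⊨ ψ)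
X ⊨ ⋁ φ = Σ ℕ λ i → X ⊨ φ i
X ⊨ ⋀ φ = ∀ i → X ⊨ φ i

data Atom : Formula → Set where
  a⊤ : Atom ⊤ᶠ
  a⊥ : Atom ⊥ᶠ
  aD : ∀ n → Atom (D n)

data Σp₀ : Formula → Set where
  atom : ∀ {φ} → Atom φ → Σp₀ φ
  conj : ∀ {φ ψ} → Σp₀ φ → Σp₀ ψ → Σp₀ (φ ∧ᶠ ψ)

data Πp₀ : Formula → Set where
  natom : ∀ {φ} → Atom φ → Πp₀ (¬ᶠ φ)
  disj  : ∀ {φ ψ} → Πp₀ φ → Πp₀ ψ → Πp₀ (φ ∨ᶠ ψ)

mutual
  data ΣpF : Ord → Formula → Set where
    σ₀ : ∀ {α φ} → α ≈ₒ ozero → Σp₀ φ → ΣpF α φ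
    σ₁ : ∀ {α} {φ : ℕ → Formula} → α ≈ₒ one → (∀ i → Σp₀ (φ i)) → ΣpF α (⋁ φ)
    σ≥₂ : ∀ {α} → two ≤ₒ α → (β : ℕ → Ord) → (∀ i → β i <ₒ α) →
          (φ ψ : ℕ → Formula) →
          (∀ i → ΣpF (β i) (φ i)) → (∀ i → ΠpF (β i) (ψ i)) →
          ΣpF α (⋁ λ i → φ i ∧ᶠ ψ i)

  data ΠpF : Ord → Formula → Set where
    π₀ : ∀ {α φ} → α ≈ₒ ozero → Πp₀ φ → ΠpF α φ
    π₁ : ∀ {α} {φ : ℕ → Formula} → α ≈ₒ one → (∀ i → Πp₀ (φ i)) → ΠpF α (⋀ φ)
    π≥₂ : ∀ {α} → two ≤ₒ α → (β : ℕ → Ord) → (∀ i → β i <ₒ α) →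
          (φ ψ : ℕ → Formula) →
          (∀ i → ΣpF (β i) (φ i)) → (∀ i → ΠpF (β i) (ψ i)) →
          ΠpF α (⋀ λ i → φ i ∨ᶠ ψ i)

⟦_⟧ : Formula → Subset
⟦ φ ⟧ X = X ⊨ φ

-- classical metatheory of the paper
ExcludedMiddle : Set₁
ExcludedMiddle = (P : Set) → P ⊎ ¬ P

{-# OPTIONS --safe #-}
-- Both inclusions go by mutual induction on the two hierarchies: a Σ⁰_α set ⋃ᵢ (Bᵢ ∖ B′ᵢ)
-- corresponds to the formula ⋁ᵢ (φᵢ ∧ ψᵢ), where φᵢ defines Bᵢ and ψᵢ the complement of B′ᵢ,
-- and dually a Π⁰_α set to ⋀ᵢ (φᵢ ∨ ψᵢ) by classical De Morgan laws. At level 1 the point is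
-- that the basic open sets are exactly the sets defined by ℕ-Σᵖ₀ formulas, and there are only
-- countably many of them, so an arbitrary union of basic open sets is a countable disjunction.
module Submission where

open import Defs
open import Data.Bool using (true; false)
open import Data.Empty using (⊥; ⊥-elim)
open import Data.List using (List; []; _∷_; _++_; length)
open import Data.List.Relation.Unary.All using (All; []; _∷_)
open import Data.List.Relation.Unary.All.Properties using (++⁺; ++⁻)
open import Data.Nat using (ℕ; zero; suc; _+_)
open import Data.Nat.Properties using (+-suc; +-identityʳ)
open import Data.Product using (Σ; ∃; _×_; _,_; proj₁; proj₂; uncurry)
open import Data.Sum using (_⊎_; inj₁; inj₂)
open import Data.Unit using (⊤; tt)
open import Function using (_∘_)
open import Function.Bundles using (_⇔_; mk⇔)
open import Relation.Nullary using (¬_)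
open import Relation.Binary.PropositionalEquality using (_≡_; refl; cong; subst; sym; trans)

variable
  α β γ : Ord
  A B C : Subset
  φ ψ : Formula

≤ₒ-refl : ∀ x → x ≤ₒ x
≤ₒ-refl ozero    = ≤-zero
≤ₒ-refl (osuc x) = ≤-succ (≤ₒ-refl x)
≤ₒ-refl (olim f) = ≤-limiting (λ k → ≤-cocone k (≤ₒ-refl (f k)))

one≈one : one ≈ₒ one
one≈one = ≤ₒ-refl one , ≤ₒ-refl one

≰one⇒≤ozero : ∀ x → ¬ (one ≤ₒ x) → x ≤ₒ ozero
≰one⇒≤ozero ozero    _   = ≤-zero
≰one⇒≤ozero (osuc x) 1≰x = ⊥-elim (1≰x (≤-succ ≤-zero))
≰one⇒≤ozero (olim f) 1≰x = ≤-limiting (λ k → ≰one⇒≤ozero (f k) (1≰x ∘ ≤-cocone k))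

≰two⇒≤one : ∀ x → ¬ (two ≤ₒ x) → x ≤ₒ one
≰two⇒≤one ozero    _   = ≤-zero
≰two⇒≤one (osuc x) 2≰x = ≤-succ (≰one⇒≤ozero x (2≰x ∘ ≤-succ))
≰two⇒≤one (olim f) 2≰x = ≤-limiting (λ k → ≰two⇒≤one (f k) (2≰x ∘ ≤-cocone k))

next : ℕ × ℕ → ℕ × ℕ
next (a , suc b) = suc a , b
next (a , zero)  = zero , suc a

unpair : ℕ → ℕ × ℕ
unpair zero    = 0 , 0
unpair (suc n) = next (unpair n)

Enumerated : ℕ × ℕ → Set
Enumerated p = ∃ λ n → unpair n ≡ p

enumerated-next : ∀ {p} → Enumerated p → Enumerated (next p)
enumerated-next (n , eq) = suc n , cong next eq

enumerated-along-diagonal : ∀ a b → Enumerated (0 , a + b) → Enumerated (a , b)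
enumerated-along-diagonal zero    b e = e
enumerated-along-diagonal (suc a) b e =
  enumerated-next (enumerated-along-diagonal a (suc b) (subst (λ d → Enumerated (0 , d)) (sym (+-suc a b)) e))

enumerated-diagonal-start : ∀ d → Enumerated (0 , d)
enumerated-diagonal-start zero    = 0 , refl
enumerated-diagonal-start (suc d) =
  enumerated-next (enumerated-along-diagonal d 0
    (subst (λ e → Enumerated (0 , e)) (sym (+-identityʳ d)) (enumerated-diagonal-start d)))

unpair-surjective : ∀ a b → Enumerated (a , b)
unpair-surjective a b = enumerated-along-diagonal a b (enumerated-diagonal-start (a + b))

decodeListOfLength : ℕ → ℕ → List ℕ
decodeListOfLength zero    c = []
decodeListOfLength (suc k) c = proj₁ (unpair c) ∷ decodeListOfLength k (proj₂ (unpair c))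

decodeListOfLength-surjective : ∀ l → ∃ λ c → decodeListOfLength (length l) c ≡ l
decodeListOfLength-surjective []      = 0 , refl
decodeListOfLength-surjective (n ∷ l) with decodeListOfLength-surjective l
... | c , eq with unpair-surjective n c
... | m , refl = m , cong (n ∷_) eq

decodeList : ℕ → List ℕ
decodeList = uncurry decodeListOfLength ∘ unpair

decodeList-surjective : ∀ l → ∃ λ n → decodeList n ≡ l
decodeList-surjective l with decodeListOfLength-surjective l
... | c , eq with unpair-surjective (length l) c
... | n , eq′ = n , trans (cong (uncurry decodeListOfLength) eq′) eq

∅ : Subset
∅ X = ⊥

infixr 7 _∩_
infixr 6 _∪_ _∖_

_∩_ _∪_ _∖_ : Subset → Subset → Subset
(A ∩ B) X = A X × B X
(A ∪ B) X = A X ⊎ B X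
(A ∖ B) X = A X × ¬ B X

⋃ ⋂ : (ℕ → Subset) → Subset
⋃ A X = Σ ℕ λ i → A i X
⋂ A X = ∀ i → A i X

≐-refl : A ≐ A
≐-refl = (λ X a → a) , (λ X a → a)

≐-sym : A ≐ B → B ≐ A
≐-sym (A⊆B , B⊆A) = B⊆A , A⊆B

≐-trans : A ≐ B → B ≐ C → A ≐ C
≐-trans (A⊆B , B⊆A) (B⊆C , C⊆B) = (λ X → B⊆C X ∘ A⊆B X) , (λ X → B⊆A X ∘ C⊆B X)

∁-cong : A ≐ B → ∁ A ≐ ∁ B
∁-cong (A⊆B , B⊆A) = (λ X ¬a → ¬a ∘ B⊆A X) , (λ X ¬b → ¬b ∘ A⊆B X)

∩-cong : ∀ {A A′ B B′} → A ≐ A′ → B ≐ B′ → (A ∩ B) ≐ (A′ ∩ B′)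
∩-cong (A⊆ , ⊇A) (B⊆ , ⊇B) = (λ X (a , b) → A⊆ X a , B⊆ X b) , (λ X (a , b) → ⊇A X a , ⊇B X b)

∪-cong : ∀ {A A′ B B′} → A ≐ A′ → B ≐ B′ → (A ∪ B) ≐ (A′ ∪ B′)
∪-cong (A⊆ , ⊇A) (B⊆ , ⊇B) =
  (λ { X (inj₁ a) → inj₁ (A⊆ X a) ; X (inj₂ b) → inj₂ (B⊆ X b) }) ,
  (λ { X (inj₁ a) → inj₁ (⊇A X a) ; X (inj₂ b) → inj₂ (⊇B X b) })

⋃-cong : {A B : ℕ → Subset} → (∀ i → A i ≐ B i) → ⋃ A ≐ ⋃ B
⋃-cong A≐B = (λ X (i , a) → i , proj₁ (A≐B i) X a) , (λ X (i , b) → i , proj₂ (A≐B i) X b)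

⋂-cong : {A B : ℕ → Subset} → (∀ i → A i ≐ B i) → ⋂ A ≐ ⋂ B
⋂-cong A≐B = (λ X a i → proj₁ (A≐B i) X (a i)) , (λ X b i → proj₂ (A≐B i) X (b i))

∁∪≐∩∁ : ∁ (A ∪ B) ≐ (∁ A ∩ ∁ B)
∁∪≐∩∁ = (λ X ¬a∪b → ¬a∪b ∘ inj₁ , ¬a∪b ∘ inj₂) ,
        (λ { X (¬a , ¬b) (inj₁ a) → ¬a a ; X (¬a , ¬b) (inj₂ b) → ¬b b })

∁⋃≐⋂∁ : {A : ℕ → Subset} → ∁ (⋃ A) ≐ ⋂ (∁ ∘ A)
∁⋃≐⋂∁ = (λ X ¬⋃a i a → ¬⋃a (i , a)) , (λ X ⋂¬a (i , a) → ⋂¬a i a)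

BorelΣ-resp : A ≐ B → BorelΣ α A → BorelΣ α B
BorelΣ-resp A≐B (open₁ α≈1 (I , b , A≐⋃)) = open₁ α≈1 (I , b , ≐-trans (≐-sym A≐B) A≐⋃)
BorelΣ-resp A≐B (union 2≤α β 1≤β β<α B B′ ΣB ΣB′ A≐⋃) =
  union 2≤α β 1≤β β<α B B′ ΣB ΣB′ (≐-trans (≐-sym A≐B) A≐⋃)

IsOpen-resp : A ≐ B → IsOpen A → IsOpen B
IsOpen-resp A≐B (I , b , A≐⋃) = I , b , ≐-trans (≐-sym A≐B) A≐⋃

Basic-open : ∀ c → IsOpen (Basic c)
Basic-open c = ⊤ , (λ _ → c) , ((λ X b → tt , b) , (λ X → proj₂))

⋃Basic-open : (c : ℕ → BasicCode) → IsOpen (⋃ (Basic ∘ c))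
⋃Basic-open c = ℕ , c , ≐-refl

meet : BasicCode → BasicCode → BasicCode
meet whole     d         = d
meet empty     d         = empty
meet (inter l) whole     = inter l
meet (inter l) empty     = empty
meet (inter l) (inter m) = inter (l ++ m)

Basic-meet : ∀ c d → Basic (meet c d) ≐ (Basic c ∩ Basic d)
Basic-meet c d = to c d , from c d
  where
  to : ∀ c d → Basic (meet c d) ⊆ (Basic c ∩ Basic d)
  to whole     d         X b = tt , b
  to (inter l) whole     X b = b , tt
  to (inter l) (inter m) X b = ++⁻ l b
  from : ∀ c d → (Basic c ∩ Basic d) ⊆ Basic (meet c d)
  from whole     d         X (_ , b) = b
  from (inter l) whole     X (a , _) = a
  from (inter l) (inter m) X (a , b) = ++⁺ a b

Atom-basic : Atom φ → Σ BasicCode λ c → ⟦ φ ⟧ ≐ Basic c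
Atom-basic a⊤     = whole , ≐-refl
Atom-basic a⊥     = empty , ≐-refl
Atom-basic (aD n) = inter (n ∷ []) , ((λ X x → x ∷ []) , (λ { X (x ∷ []) → x }))

Σp₀-basic : Σp₀ φ → Σ BasicCode λ c → ⟦ φ ⟧ ≐ Basic c
Σp₀-basic (atom a)   = Atom-basic a
Σp₀-basic (conj p q) with Σp₀-basic p | Σp₀-basic q
... | c , φ≐c | d , ψ≐d = meet c d , ≐-trans (∩-cong φ≐c ψ≐d) (≐-sym (Basic-meet c d))

allD : List ℕ → Formula
allD []      = ⊤ᶠ
allD (n ∷ l) = D n ∧ᶠ allD l

allD-Σp₀ : ∀ l → Σp₀ (allD l)
allD-Σp₀ []      = atom a⊤
allD-Σp₀ (n ∷ l) = conj (atom (aD n)) (allD-Σp₀ l)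

⟦allD⟧ : ∀ l → ⟦ allD l ⟧ ≐ Basic (inter l)
⟦allD⟧ l = to l , from l
  where
  to : ∀ l → ⟦ allD l ⟧ ⊆ Basic (inter l)
  to []      X _       = []
  to (n ∷ l) X (x , s) = x ∷ to l X s
  from : ∀ l → Basic (inter l) ⊆ ⟦ allD l ⟧
  from []      X _       = tt
  from (n ∷ l) X (x ∷ s) = x , from l X s

someNotD : List ℕ → Formula
someNotD []      = ¬ᶠ ⊤ᶠ
someNotD (n ∷ l) = (¬ᶠ D n) ∨ᶠ someNotD l

someNotD-Πp₀ : ∀ l → Πp₀ (someNotD l)
someNotD-Πp₀ []      = natom a⊤
someNotD-Πp₀ (n ∷ l) = disj (natom (aD n)) (someNotD-Πp₀ l)

⟦someNotD⟧ : ∀ l → ⟦ someNotD l ⟧ ≐ ∁ (Basic (inter l))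
⟦someNotD⟧ l = to l , from l
  where
  to : ∀ l → ⟦ someNotD l ⟧ ⊆ ∁ (Basic (inter l))
  to []      X ¬⊤        _       = ¬⊤ tt
  to (n ∷ l) X (inj₁ ¬x) (x ∷ _) = ¬x x
  to (n ∷ l) X (inj₂ s)  (_ ∷ b) = to l X s b
  from : ∀ l → ∁ (Basic (inter l)) ⊆ ⟦ someNotD l ⟧
  from []      X ¬b _ = ¬b []
  from (n ∷ l) X ¬b with X n in eq
  ... | false = inj₁ λ ()
  ... | true  = inj₂ (from l X (¬b ∘ (eq ∷_)))

basicΣ : BasicCode → Formula
basicΣ whole     = ⊤ᶠ
basicΣ empty     = ⊥ᶠ
basicΣ (inter l) = allD l

basicΣ-Σp₀ : ∀ c → Σp₀ (basicΣ c)
basicΣ-Σp₀ whole     = atom a⊤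
basicΣ-Σp₀ empty     = atom a⊥
basicΣ-Σp₀ (inter l) = allD-Σp₀ l

⟦basicΣ⟧ : ∀ c → ⟦ basicΣ c ⟧ ≐ Basic c
⟦basicΣ⟧ whole     = ≐-refl
⟦basicΣ⟧ empty     = ≐-refl
⟦basicΣ⟧ (inter l) = ⟦allD⟧ l

basicΠ : BasicCode → Formula
basicΠ whole     = ¬ᶠ ⊤ᶠ
basicΠ empty     = ¬ᶠ ⊥ᶠ
basicΠ (inter l) = someNotD l

basicΠ-Πp₀ : ∀ c → Πp₀ (basicΠ c)
basicΠ-Πp₀ whole     = natom a⊤
basicΠ-Πp₀ empty     = natom a⊥
basicΠ-Πp₀ (inter l) = someNotD-Πp₀ l

⟦basicΠ⟧ : ∀ c → ⟦ basicΠ c ⟧ ≐ ∁ (Basic c)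
⟦basicΠ⟧ whole     = ≐-refl
⟦basicΠ⟧ empty     = ≐-refl
⟦basicΠ⟧ (inter l) = ⟦someNotD⟧ l

Basic-neighbourhood : ∀ c {X} → Basic c X → Σ (List ℕ) λ l → Basic (inter l) X × Basic (inter l) ⊆ Basic c
Basic-neighbourhood whole     _ = [] , [] , (λ _ _ → tt)
Basic-neighbourhood (inter l) b = l , b , (λ _ b′ → b′)

open-neighbourhood : IsOpen A → ∀ {X} → A X → Σ (List ℕ) λ l → Basic (inter l) X × Basic (inter l) ⊆ A
open-neighbourhood (I , b , A⊆⋃ , ⋃⊆A) a with A⊆⋃ _ a
... | i , x∈bᵢ with Basic-neighbourhood (b i) x∈bᵢ
... | l , x∈l , l⊆bᵢ = l , x∈l , (λ Y y∈l → ⋃⊆A Y (i , l⊆bᵢ Y y∈l))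

Σp₀-open : Σp₀ φ → IsOpen ⟦ φ ⟧
Σp₀-open p with Σp₀-basic p
... | c , φ≐c = IsOpen-resp (≐-sym φ≐c) (Basic-open c)

⋁Σp₀-open : {φ : ℕ → Formula} → (∀ i → Σp₀ (φ i)) → IsOpen ⟦ ⋁ φ ⟧
⋁Σp₀-open {φ} p =
  IsOpen-resp (⋃-cong {B = λ i → ⟦ φ i ⟧} (≐-sym ∘ proj₂ ∘ Σp₀-basic ∘ p)) (⋃Basic-open (proj₁ ∘ Σp₀-basic ∘ p))

ΣDefinable ΠDefinable : Ord → Subset → Set
ΣDefinable α A = Σ Formula λ φ → ΣpF α φ × (A ≐ ⟦ φ ⟧)
ΠDefinable α A = Σ Formula λ φ → ΠpF α φ × (A ≐ ⟦ φ ⟧)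

ΠDefinable-resp : A ≐ B → ΠDefinable α B → ΠDefinable α A
ΠDefinable-resp A≐B (φ , Πφ , B≐φ) = φ , Πφ , ≐-trans A≐B B≐φ

⋃∖≐⟦⋁∧⟧ : {B B′ : ℕ → Subset} {φ ψ : ℕ → Formula} →
          (∀ i → B i ≐ ⟦ φ i ⟧) → (∀ i → ∁ (B′ i) ≐ ⟦ ψ i ⟧) →
          ⋃ (λ i → B i ∖ B′ i) ≐ ⟦ ⋁ (λ i → φ i ∧ᶠ ψ i) ⟧
⋃∖≐⟦⋁∧⟧ B≐φ ∁B′≐ψ = ⋃-cong λ i → ∩-cong (B≐φ i) (∁B′≐ψ i)

module Classical (em : ExcludedMiddle) where

  dne : {P : Set} → ¬ ¬ P → P
  dne {P} ¬¬p with em P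
  ... | inj₁ p  = p
  ... | inj₂ ¬p = ⊥-elim (¬¬p ¬p)

  ∁∁ : ∁ (∁ A) ≐ A
  ∁∁ = (λ X → dne) , (λ X a ¬a → ¬a a)

  ∁⋂≐⋃∁ : {A : ℕ → Subset} → ∁ (⋂ A) ≐ ⋃ (∁ ∘ A)
  ∁⋂≐⋃∁ = (λ X ¬⋂ → dne λ ¬⋃∁ → ¬⋂ λ i → dne λ ¬aᵢ → ¬⋃∁ (i , ¬aᵢ)) , (λ X (i , ¬aᵢ) ⋂a → ¬aᵢ (⋂a i))

  ∁∖≐∪∁ : ∁ (A ∖ B) ≐ (B ∪ ∁ A)
  ∁∖≐∪∁ {A} {B} = to , (λ { X (inj₁ b) (_ , ¬b) → ¬b b ; X (inj₂ ¬a) (a , _) → ¬a a })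
    where
    to : ∁ (A ∖ B) ⊆ (B ∪ ∁ A)
    to X ¬a∖b with em (B X)
    ... | inj₁ b  = inj₁ b
    ... | inj₂ ¬b = inj₂ λ a → ¬a∖b (a , ¬b)

  ∁⋃∖≐⟦⋀∨⟧ : {B B′ : ℕ → Subset} {φ ψ : ℕ → Formula} →
             (∀ i → B′ i ≐ ⟦ φ i ⟧) → (∀ i → ∁ (B i) ≐ ⟦ ψ i ⟧) →
             ∁ (⋃ (λ i → B i ∖ B′ i)) ≐ ⟦ ⋀ (λ i → φ i ∨ᶠ ψ i) ⟧
  ∁⋃∖≐⟦⋀∨⟧ B′≐φ ∁B≐ψ = ≐-trans ∁⋃≐⋂∁ (⋂-cong λ i → ≐-trans ∁∖≐∪∁ (∪-cong (B′≐φ i) (∁B≐ψ i)))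

  Πp₀-basic : Πp₀ φ → Σ BasicCode λ c → ∁ ⟦ φ ⟧ ≐ Basic c
  Πp₀-basic (natom a) with Atom-basic a
  ... | c , φ≐c = c , ≐-trans ∁∁ φ≐c
  Πp₀-basic (disj p q) with Πp₀-basic p | Πp₀-basic q
  ... | c , ∁φ≐c | d , ∁ψ≐d =
    meet c d , ≐-trans ∁∪≐∩∁ (≐-trans (∩-cong ∁φ≐c ∁ψ≐d) (≐-sym (Basic-meet c d)))

  Πp₀-open : Πp₀ φ → IsOpen (∁ ⟦ φ ⟧)
  Πp₀-open p with Πp₀-basic p
  ... | c , ∁φ≐c = IsOpen-resp (≐-sym ∁φ≐c) (Basic-open c)

  ⋀Πp₀-open : {φ : ℕ → Formula} → (∀ i → Πp₀ (φ i)) → IsOpen (∁ ⟦ ⋀ φ ⟧)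
  ⋀Πp₀-open {φ} p =
    IsOpen-resp (≐-trans (⋃-cong (≐-sym ∘ proj₂ ∘ Πp₀-basic ∘ p)) (≐-sym (∁⋂≐⋃∁ {λ i → ⟦ φ i ⟧})))
                (⋃Basic-open (proj₁ ∘ Πp₀-basic ∘ p))

  countable-base : IsOpen A → Σ (ℕ → BasicCode) λ c → A ≐ ⋃ (Basic ∘ c)
  countable-base {A} A-open = selected ∘ decodeList , cover , sound
    where
    selected : List ℕ → BasicCode
    selected l with em (Basic (inter l) ⊆ A)
    ... | inj₁ _ = inter l
    ... | inj₂ _ = empty
    selected-⊆ : ∀ l → Basic (selected l) ⊆ A
    selected-⊆ l with em (Basic (inter l) ⊆ A)
    ... | inj₁ l⊆A = l⊆A
    ... | inj₂ _   = λ X ()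
    selected-⊇ : ∀ {l} → Basic (inter l) ⊆ A → Basic (inter l) ⊆ Basic (selected l)
    selected-⊇ {l} l⊆A with em (Basic (inter l) ⊆ A)
    ... | inj₁ _   = λ X x∈l → x∈l
    ... | inj₂ l⊈A = ⊥-elim (l⊈A l⊆A)
    sound : ⋃ (Basic ∘ selected ∘ decodeList) ⊆ A
    sound X (n , x∈sel) = selected-⊆ (decodeList n) X x∈sel
    cover : A ⊆ ⋃ (Basic ∘ selected ∘ decodeList)
    cover X a with open-neighbourhood A-open a
    ... | l , x∈l , l⊆A with decodeList-surjective l
    ... | n , refl = n , selected-⊇ l⊆A X x∈l

  open-ΣDefinable : α ≈ₒ one → IsOpen A → ΣDefinable α A
  open-ΣDefinable α≈1 A-open with countable-base A-open
  ... | c , A≐⋃ = ⋁ (basicΣ ∘ c) , σ₁ α≈1 (basicΣ-Σp₀ ∘ c) , ≐-trans A≐⋃ (⋃-cong (≐-sym ∘ ⟦basicΣ⟧ ∘ c))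

  open-∁ΠDefinable : α ≈ₒ one → IsOpen A → ΠDefinable α (∁ A)
  open-∁ΠDefinable α≈1 A-open with countable-base A-open
  ... | c , A≐⋃ =
    ⋀ (basicΠ ∘ c) , π₁ α≈1 (basicΠ-Πp₀ ∘ c) ,
    ≐-trans (∁-cong A≐⋃) (≐-trans ∁⋃≐⋂∁ (⋂-cong (≐-sym ∘ ⟦basicΠ⟧ ∘ c)))

  mutual
    BorelΣ⇒ΣDefinable : BorelΣ α A → ΣDefinable α A
    BorelΣ⇒ΣDefinable (open₁ α≈1 A-open) = open-ΣDefinable α≈1 A-open
    BorelΣ⇒ΣDefinable (union 2≤α βs _ βs<α B B′ ΣB ΣB′ A≐⋃) =
      ⋁ (λ i → φs i ∧ᶠ ψs i) , σ≥₂ 2≤α βs βs<α φs ψs (proj₁ ∘ proj₂ ∘ defB) (proj₁ ∘ proj₂ ∘ def∁B′) ,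
      ≐-trans A≐⋃ (⋃∖≐⟦⋁∧⟧ (proj₂ ∘ proj₂ ∘ defB) (proj₂ ∘ proj₂ ∘ def∁B′))
      where
      defB : ∀ i → ΣDefinable (βs i) (B i)
      defB i = BorelΣ⇒ΣDefinable (ΣB i)
      def∁B′ : ∀ i → ΠDefinable (βs i) (∁ (B′ i))
      def∁B′ i = BorelΣ⇒∁ΠDefinable (ΣB′ i)
      φs ψs : ℕ → Formula
      φs = proj₁ ∘ defB
      ψs = proj₁ ∘ def∁B′

    BorelΣ⇒∁ΠDefinable : BorelΣ α A → ΠDefinable α (∁ A)
    BorelΣ⇒∁ΠDefinable (open₁ α≈1 A-open) = open-∁ΠDefinable α≈1 A-open
    BorelΣ⇒∁ΠDefinable (union 2≤α βs _ βs<α B B′ ΣB ΣB′ A≐⋃) =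
      ⋀ (λ i → φs i ∨ᶠ ψs i) , π≥₂ 2≤α βs βs<α φs ψs (proj₁ ∘ proj₂ ∘ defB′) (proj₁ ∘ proj₂ ∘ def∁B) ,
      ≐-trans (∁-cong A≐⋃) (∁⋃∖≐⟦⋀∨⟧ (proj₂ ∘ proj₂ ∘ defB′) (proj₂ ∘ proj₂ ∘ def∁B))
      where
      defB′ : ∀ i → ΣDefinable (βs i) (B′ i)
      defB′ i = BorelΣ⇒ΣDefinable (ΣB′ i)
      def∁B : ∀ i → ΠDefinable (βs i) (∁ (B i))
      def∁B i = BorelΣ⇒∁ΠDefinable (ΣB i)
      φs ψs : ℕ → Formula
      φs = proj₁ ∘ defB′
      ψs = proj₁ ∘ def∁B

  open⇒BorelΣ : one ≤ₒ γ → IsOpen A → BorelΣ γ A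
  open⇒BorelΣ {γ} {A} 1≤γ A-open with em (two ≤ₒ γ)
  ... | inj₂ 2≰γ = open₁ (≰two⇒≤one γ 2≰γ , 1≤γ) A-open
  ... | inj₁ 2≤γ =
    union 2≤γ (λ _ → one) (λ _ → ≤ₒ-refl one) (λ _ → 2≤γ) (λ _ → A) (λ _ → ∅)
          (λ _ → open₁ one≈one A-open) (λ _ → open₁ one≈one (Basic-open empty))
          ((λ X a → 0 , a , λ ()) , (λ X (_ , a , _) → a))

  -- Formula levels start at 0 but Borel levels at 1.
  raise : Ord → Ord
  raise β with em (one ≤ₒ β)
  ... | inj₁ _ = β
  ... | inj₂ _ = one

  one≤raise : ∀ β → one ≤ₒ raise β
  one≤raise β with em (one ≤ₒ β)
  ... | inj₁ 1≤β = 1≤β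
  ... | inj₂ _   = ≤ₒ-refl one

  ≤raise : ∀ β → β ≤ₒ raise β
  ≤raise β with em (one ≤ₒ β)
  ... | inj₁ _   = ≤ₒ-refl β
  ... | inj₂ 1≰β = ≤-trans (≰one⇒≤ozero β 1≰β) ≤-zero

  raise< : two ≤ₒ γ → β <ₒ γ → raise β <ₒ γ
  raise< {β = β} 2≤γ β<γ with em (one ≤ₒ β)
  ... | inj₁ _ = β<γ
  ... | inj₂ _ = 2≤γ

  mutual
    ΣpF⇒BorelΣ : ΣpF β φ → β ≤ₒ γ → one ≤ₒ γ → BorelΣ γ ⟦ φ ⟧
    ΣpF⇒BorelΣ (σ₀ _ p) _ 1≤γ = open⇒BorelΣ 1≤γ (Σp₀-open p)
    ΣpF⇒BorelΣ (σ₁ _ p) _ 1≤γ = open⇒BorelΣ 1≤γ (⋁Σp₀-open p)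
    ΣpF⇒BorelΣ (σ≥₂ 2≤β βs βs<β φs ψs Σφs Πψs) β≤γ _ =
      union 2≤γ (raise ∘ βs) (one≤raise ∘ βs) (λ i → raise< 2≤γ (≤-trans (βs<β i) β≤γ))
            (λ i → ⟦ φs i ⟧) (λ i → ∁ ⟦ ψs i ⟧)
            (λ i → ΣpF⇒BorelΣ (Σφs i) (≤raise (βs i)) (one≤raise (βs i)))
            (λ i → ΠpF⇒BorelΠ (Πψs i) (≤raise (βs i)) (one≤raise (βs i)))
            (≐-sym (⋃∖≐⟦⋁∧⟧ (λ _ → ≐-refl) (λ _ → ∁∁)))
      where
      2≤γ = ≤-trans 2≤β β≤γ

    ΠpF⇒BorelΠ : ΠpF β φ → β ≤ₒ γ → one ≤ₒ γ → BorelΠ γ ⟦ φ ⟧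
    ΠpF⇒BorelΠ (π₀ _ p) _ 1≤γ = open⇒BorelΣ 1≤γ (Πp₀-open p)
    ΠpF⇒BorelΠ (π₁ _ p) _ 1≤γ = open⇒BorelΣ 1≤γ (⋀Πp₀-open p)
    ΠpF⇒BorelΠ (π≥₂ 2≤β βs βs<β φs ψs Σφs Πψs) β≤γ _ =
      union 2≤γ (raise ∘ βs) (one≤raise ∘ βs) (λ i → raise< 2≤γ (≤-trans (βs<β i) β≤γ))
            (λ i → ∁ ⟦ ψs i ⟧) (λ i → ⟦ φs i ⟧)
            (λ i → ΠpF⇒BorelΠ (Πψs i) (≤raise (βs i)) (one≤raise (βs i)))
            (λ i → ΣpF⇒BorelΣ (Σφs i) (≤raise (βs i)) (one≤raise (βs i)))
            (≐-trans (∁-cong (≐-sym (∁⋃∖≐⟦⋀∨⟧ (λ _ → ≐-refl) (λ _ → ∁∁)))) ∁∁)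
      where
      2≤γ = ≤-trans 2≤β β≤γ

  ΣDefinable⇒BorelΣ : one ≤ₒ α → ΣDefinable α A → BorelΣ α A
  ΣDefinable⇒BorelΣ {α} 1≤α (φ , Σφ , A≐φ) = BorelΣ-resp (≐-sym A≐φ) (ΣpF⇒BorelΣ Σφ (≤ₒ-refl α) 1≤α)

  ΠDefinable⇒BorelΠ : one ≤ₒ α → ΠDefinable α A → BorelΠ α A
  ΠDefinable⇒BorelΠ {α} 1≤α (φ , Πφ , A≐φ) = BorelΣ-resp (∁-cong (≐-sym A≐φ)) (ΠpF⇒BorelΠ Πφ (≤ₒ-refl α) 1≤α)

  BorelΠ⇒ΠDefinable : BorelΠ α A → ΠDefinable α A
  BorelΠ⇒ΠDefinable ΣA = ΠDefinable-resp (≐-sym ∁∁) (BorelΣ⇒∁ΠDefinable ΣA)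

mainTheorem5 : ExcludedMiddle → (α : Ord) → ozero <ₒ α →
    ((A : Subset) → BorelΣ α A ⇔ Σ Formula (λ φ → ΣpF α φ × (A ≐ ⟦ φ ⟧)))
    × ((A : Subset) → BorelΠ α A ⇔ Σ Formula (λ φ → ΠpF α φ × (A ≐ ⟦ φ ⟧)))
mainTheorem5 em α 1≤α =
  (λ A → mk⇔ BorelΣ⇒ΣDefinable (ΣDefinable⇒BorelΣ 1≤α)) ,
  (λ A → mk⇔ BorelΠ⇒ΠDefinable (ΠDefinable⇒BorelΠ 1≤α))
  where open Classical em
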